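{- Let $b_0\ge 2$ and assume that $S_{x^2,b_0}$ has $s$ distinct propagating cycles of lengths $\ell_1,\dots,\ell_s$ respectively (repetitions among the $\ell_i$ allowed). Let $\mathbf{t}\ge0$ be any integer and let $b=b_0+\mathbf{t}(b_0^2+1)$. Then $S_{x^2,b}$ has at least $s$ distinct propagating cycles, of lengths $\ell_1,\dots,\ell_s$ respectively.
   Context: For an integer $b\ge2$, define $S_{x^2,b}:\mathbb{Z}_{\ge0}\to\mathbb{Z}_{\ge0}$ by $S_{x^2,b}(n)=x_0^2+\dots+x_d^2$, where $n=x_0+x_1b+\dots+x_db^d$ is the base-$b$ expansion of $n$ ($0\le x_i<b$). A cycle of length $\ell$ of $S_{x^2,b}$ is a sequence of pairwise distinct positive integers $\mathrm{cyc}(n_1,\dots,n_\ell)$ with $S_{x^2,b}(n_i)=n_{i+1}$ for $1\le i<\ell$ and $S_{x^2,b}(n_\ell)=n_1$, considered up to cyclic permutation (distinct cycles means distinct up to cyclic permutation). Such a cycle is propagating if every $n_i$ has at most two base-$b$ digits and $b$ divides no $n_i$. -}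

module Defs where

open import Data.Nat using (ℕ; zero; suc; _+_; _*_; _^_; _<_; _≤_)
open import Data.Nat.DivMod using (_/_; _%_)
open import Data.Nat.Divisibility using (_∣_)
open import Data.List using (List; []; _∷_; _++_; [_]; map; length)
open import Data.List.Relation.Unary.All using (All)
open import Data.List.Relation.Unary.Unique.Propositional using (Unique)
open import Data.Product using (∃; _×_)
open import Relation.Binary.PropositionalEquality using (_≡_)
open import Relation.Nullary using (¬_)

-- Sum of squares of the base-b digits, computed with fuel.
-- Fuel n suffices for base b ≥ 2 (n has at most n digits).
-- Bases 0 and 1 are junk (value 0); they never occur in the theorem.
SFuel : ℕ → ℕ → ℕ → ℕ
SFuel zero          b n = 0
SFuel (suc k) zero          n = 0
SFuel (suc k) (suc zero)    n = 0
SFuel (suc k) (suc (suc c)) n =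
  (n % suc (suc c)) ^ 2 + SFuel k (suc (suc c)) (n / suc (suc c))

S : ℕ → ℕ → ℕ
S b n = SFuel n b n

rot : List ℕ → List ℕ
rot []       = []
rot (x ∷ xs) = xs ++ [ x ]

rotN : ℕ → List ℕ → List ℕ
rotN zero    xs = xs
rotN (suc k) xs = rotN k (rot xs)

-- A cycle cyc(n1,...,nl) of S_{x^2,b}, represented by the list [n1,...,nl]:
-- nonempty, positive, pairwise distinct entries, S(n_i)=n_{i+1}, S(n_l)=n_1.
IsCycle : ℕ → List ℕ → Set
IsCycle b xs = (1 ≤ length xs) × All (λ n → 0 < n) xs × Unique xs × (map (S b) xs ≡ rot xs)

SameCycle : List ℕ → List ℕ → Set
SameCycle xs ys = ∃ λ k → rotN k xs ≡ ys

IsPropagatingCycle : ℕ → List ℕ → Set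
IsPropagatingCycle b xs = IsCycle b xs × All (λ n → n < b ^ 2 × ¬ (b ∣ n)) xs

{-# OPTIONS --safe #-}
module Submission where

-- With a = 1 + t b₀ the map n ↦ (a² + t²) n sends a propagating number
-- n = x + y b₀ to a two-digit number in base b = b₀ + t (b₀² + 1), whose digits
-- X = a x − t y and Y = t x + a y are the coordinates of (a + t i)(x + y i).
-- Multiplicativity of the norm of Gaussian integers then gives
-- S_b((a² + t²) n) = (a² + t²) S_b₀(n), so the multiplication carries each
-- propagating cycle of S_b₀ to one of S_b of the same length, injectively.

open import Defs
open import Data.Nat
open import Data.Nat.Properties
open import Data.Nat.DivMod
open import Data.Nat.Divisibility
open import Data.Nat.Tactic.RingSolver using (solve-∀)
open import Algebra.Properties.CommutativeSemigroup +-commutativeSemigroup using (xy∙z≈xz∙y)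
open import Data.List using (List; []; _∷_; [_]; map; length)
open import Data.List.Properties using (map-++; length-map; map-∘; map-cong; map-cong-local; map-injective)
open import Data.List.Relation.Unary.All as All using (All)
import Data.List.Relation.Unary.All.Properties as All
open import Data.List.Relation.Unary.AllPairs as AllPairs using (AllPairs)
import Data.List.Relation.Unary.AllPairs.Properties as AllPairs
import Data.List.Relation.Unary.Unique.Propositional.Properties as Unique
open import Data.Product using (∃; _×_; _,_; proj₁)
open import Function.Base using (_∘_)
open import Function.Definitions using (Injective)
open import Relation.Nullary using (¬_)
open import Relation.Binary.PropositionalEquality using (_≡_; _≢_; refl; sym; trans; cong; cong₂; subst; module ≡-Reasoning)

record TwoDigits (b n : ℕ) : Set where
  field
    low high : ℕ
    low>0  : 0 < low
    low<b  : low < b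
    high<b : high < b
    value  : n ≡ low + high * b

open TwoDigits

SFuel-0 : ∀ k c → SFuel k (2 + c) 0 ≡ 0
SFuel-0 zero    c = refl
SFuel-0 (suc k) c = SFuel-0 k c

SFuel-digit : ∀ k {c y} → y < 2 + c → y ≤ k → SFuel k (2 + c) y ≡ y ^ 2
SFuel-digit zero    y<b z≤n = refl
SFuel-digit (suc k) {c} {y} y<b _
  rewrite m<n⇒m%n≡m y<b | m<n⇒m/n≡0 y<b | SFuel-0 k c = +-identityʳ (y ^ 2)

SFuel-step : ∀ k {c} x y → x < 2 + c →
             SFuel (suc k) (2 + c) (x + y * (2 + c)) ≡ x ^ 2 + SFuel k (2 + c) y
SFuel-step k {c} x y x<b = cong₂ (λ u v → u ^ 2 + SFuel k (2 + c) v) low-digit high-digit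
  where
  low-digit : (x + y * (2 + c)) % (2 + c) ≡ x
  low-digit = trans ([m+kn]%n≡m%n x y (2 + c)) (m<n⇒m%n≡m x<b)
  high-digit : (x + y * (2 + c)) / (2 + c) ≡ y
  high-digit = begin
    (x + y * (2 + c)) / (2 + c)          ≡⟨ +-distrib-/-∣ʳ x (divides y refl) ⟩
    x / (2 + c) + y * (2 + c) / (2 + c)  ≡⟨ cong₂ _+_ (m<n⇒m/n≡0 x<b) (m*n/n≡m y (2 + c)) ⟩
    y                                    ∎
    where open ≡-Reasoning

S-two-digits : ∀ {b x y} → 0 < x → x < b → y < b → S b (x + y * b) ≡ x ^ 2 + y ^ 2
S-two-digits {suc zero} {suc x} _ (s≤s ()) _
S-two-digits {suc (suc c)} {suc x} {y} _ x<b y<b =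
  trans (SFuel-step (x + y * (2 + c)) (suc x) y x<b)
        (cong (suc x ^ 2 +_) (SFuel-digit _ y<b (≤-trans (m≤m*n y (2 + c)) (m≤n+m _ x))))

square : ∀ n → n ^ 2 ≡ n * n
square n = cong (n *_) (*-identityʳ n)

S-TwoDigits : ∀ {b n} (d : TwoDigits b n) → S b n ≡ low d * low d + high d * high d
S-TwoDigits {b} {n} d = begin
  S b n                               ≡⟨ cong (S b) (value d) ⟩
  S b (low d + high d * b)            ≡⟨ S-two-digits (low>0 d) (low<b d) (high<b d) ⟩
  low d ^ 2 + high d ^ 2              ≡⟨ cong₂ _+_ (square (low d)) (square (high d)) ⟩
  low d * low d + high d * high d     ∎
  where open ≡-Reasoning

TwoDigits⇒propagating : ∀ {b n} → TwoDigits b n → n < b ^ 2 × ¬ (b ∣ n)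
TwoDigits⇒propagating {b} {n} d = n<b² , b∤n
  where
  n<b² : n < b ^ 2
  n<b² = begin-strict
    n                    ≡⟨ value d ⟩
    low d + high d * b   <⟨ +-monoˡ-< (high d * b) (low<b d) ⟩
    b + high d * b       ≤⟨ *-monoˡ-≤ b (high<b d) ⟩
    b * b                ≡⟨ square b ⟨
    b ^ 2                ∎
    where open ≤-Reasoning
  b∤n : ¬ (b ∣ n)
  b∤n b∣n = <⇒≱ (low<b d) (∣⇒≤ {{>-nonZero (low>0 d)}} b∣low)
    where
    b∣low : b ∣ low d
    b∣low = ∣m+n∣m⇒∣n (subst (b ∣_) (trans (value d) (+-comm (low d) (high d * b))) b∣n)
                      (divides (high d) refl)

propagating⇒TwoDigits : ∀ {b n} .{{_ : NonZero b}} → n < b ^ 2 → ¬ (b ∣ n) → TwoDigits b n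
propagating⇒TwoDigits {b} {n} n<b² b∤n = record
  { low    = n % b
  ; high   = n / b
  ; low>0  = n≢0⇒n>0 low≢0
  ; low<b  = m%n<n n b
  ; high<b = m<n*o⇒m/o<n (subst (n <_) (square b) n<b²)
  ; value  = m≡m%n+[m/n]*n n b
  }
  where
  low≢0 : n % b ≢ 0
  low≢0 low≡0 = b∤n (divides (n / b) (trans (m≡m%n+[m/n]*n n b) (cong (_+ n / b * b) low≡0)))

complete-square : ∀ v u q → v * v + q * q + 2 * (v + u) * u ≡ (v + u) * (v + u) + u * u + q * q
complete-square = solve-∀

brahmagupta-expanded : ∀ a c x y →
  a * x * (a * x) + c * y * (c * y) + (c * x + a * y) * (c * x + a * y)
  ≡ (a * a + c * c) * (x * x + y * y) + 2 * (a * x) * (c * y)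
brahmagupta-expanded = solve-∀

-- Brahmagupta–Fibonacci identity, with a x − c y written as X to avoid truncated subtraction.
norm-multiplicative : ∀ a c x y X → a * x ≡ X + c * y →
                      X * X + (c * x + a * y) * (c * x + a * y) ≡ (a * a + c * c) * (x * x + y * y)
norm-multiplicative a c x y X ax≡X+cy = +-cancelʳ-≡ (2 * (a * x) * (c * y)) _ _ (begin
  X * X + Q * Q + 2 * (a * x) * (c * y)
    ≡⟨ cong (λ p → X * X + Q * Q + 2 * p * (c * y)) ax≡X+cy ⟩
  X * X + Q * Q + 2 * (X + c * y) * (c * y)
    ≡⟨ complete-square X (c * y) Q ⟩
  (X + c * y) * (X + c * y) + c * y * (c * y) + Q * Q
    ≡⟨ cong (λ p → p * p + c * y * (c * y) + Q * Q) ax≡X+cy ⟨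
  a * x * (a * x) + c * y * (c * y) + Q * Q
    ≡⟨ brahmagupta-expanded a c x y ⟩
  (a * a + c * c) * (x * x + y * y) + 2 * (a * x) * (c * y) ∎)
  where
  open ≡-Reasoning
  Q : ℕ
  Q = c * x + a * y

map-rot : ∀ (f : ℕ → ℕ) xs → map f (rot xs) ≡ rot (map f xs)
map-rot f []       = refl
map-rot f (x ∷ xs) = map-++ f xs [ x ]

map-rotN : ∀ (f : ℕ → ℕ) k xs → map f (rotN k xs) ≡ rotN k (map f xs)
map-rotN f zero    xs = refl
map-rotN f (suc k) xs = trans (map-rotN f k (rot xs)) (cong (rotN k) (map-rot f xs))

¬SameCycle-map : ∀ {f : ℕ → ℕ} → Injective _≡_ _≡_ f →
                 ∀ {xs ys} → ¬ SameCycle xs ys → ¬ SameCycle (map f xs) (map f ys)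
¬SameCycle-map {f} f-inj {xs} ¬xs~ys (k , rotN-k-fxs≡fys) =
  ¬xs~ys (k , map-injective f-inj (trans (map-rotN f k xs) rotN-k-fxs≡fys))

IsCycle-map : ∀ {b₀ b} {f : ℕ → ℕ} → Injective _≡_ _≡_ f → (∀ {n} → 0 < n → 0 < f n) →
              ∀ {xs} → All (λ n → S b (f n) ≡ f (S b₀ n)) xs →
              IsCycle b₀ xs → IsCycle b (map f xs)
IsCycle-map {b₀} {b} {f} f-inj f-pos {xs} f-conj (nonempty , pos , distinct , S-rot) =
  subst (1 ≤_) (sym (length-map f xs)) nonempty ,
  All.map⁺ (All.map f-pos pos) ,
  Unique.map⁺ f-inj distinct ,
  (begin
    map (S b) (map f xs)   ≡⟨ map-∘ xs ⟨
    map (S b ∘ f) xs       ≡⟨ map-cong-local f-conj ⟩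
    map (f ∘ S b₀) xs      ≡⟨ map-∘ xs ⟩
    map f (map (S b₀) xs)  ≡⟨ cong (map f) S-rot ⟩
    map f (rot xs)         ≡⟨ map-rot f xs ⟩
    rot (map f xs)         ∎)
  where open ≡-Reasoning

module Lift (b₀ t : ℕ) .{{_ : NonZero b₀}} where

  a : ℕ
  a = suc (t * b₀)

  M : ℕ
  M = a * a + t * t

  b : ℕ
  b = b₀ + t * (b₀ ^ 2 + 1)

  base-change : ∀ x y X → a * x ≡ X + t * y → M * (x + y * b₀) ≡ X + (t * x + a * y) * b
  base-change x y X ax≡X+ty = +-cancelʳ-≡ (t * y) _ _ (begin
    M * (x + y * b₀) + t * y
      ≡⟨ base-change-expanded b₀ t x y ⟩
    a * x + (t * x + a * y) * (b₀ + t * (b₀ * b₀ + 1))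
      ≡⟨ cong (λ s → a * x + (t * x + a * y) * (b₀ + t * (s + 1))) (square b₀) ⟨
    a * x + (t * x + a * y) * b
      ≡⟨ cong (_+ (t * x + a * y) * b) ax≡X+ty ⟩
    X + t * y + (t * x + a * y) * b
      ≡⟨ xy∙z≈xz∙y X (t * y) _ ⟩
    X + (t * x + a * y) * b + t * y ∎)
    where
    open ≡-Reasoning
    base-change-expanded : ∀ b₀ t x y →
      ((1 + t * b₀) * (1 + t * b₀) + t * t) * (x + y * b₀) + t * y
      ≡ (1 + t * b₀) * x + (t * x + (1 + t * b₀) * y) * (b₀ + t * (b₀ * b₀ + 1))
    base-change-expanded = solve-∀

  module _ {n : ℕ} (d : TwoDigits b₀ n) where
    private
      x y D X Y : ℕ
      x = low d
      y = high d
      D = b₀ * x ∸ y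
      X = x + t * D
      Y = t * x + a * y

      y≤b₀x : y ≤ b₀ * x
      y≤b₀x = ≤-trans (<⇒≤ (high<b d)) (m≤m*n b₀ x {{>-nonZero (low>0 d)}})

      ax≡X+ty : a * x ≡ X + t * y
      ax≡X+ty = begin
        a * x               ≡⟨ cong (x +_) (*-assoc t b₀ x) ⟩
        x + t * (b₀ * x)    ≡⟨ cong (λ m → x + t * m) (m∸n+n≡m y≤b₀x) ⟨
        x + t * (D + y)     ≡⟨ cong (x +_) (*-distribˡ-+ t D y) ⟩
        x + (t * D + t * y) ≡⟨ +-assoc x (t * D) (t * y) ⟨
        X + t * y           ∎
        where open ≡-Reasoning

      b₀²≤b₀²+1 : b₀ ^ 2 ≤ b₀ ^ 2 + 1
      b₀²≤b₀²+1 = m≤m+n (b₀ ^ 2) 1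

      D≤b₀²+1 : D ≤ b₀ ^ 2 + 1
      D≤b₀²+1 = ≤-trans (m∸n≤m (b₀ * x) y)
               (≤-trans (*-monoʳ-≤ b₀ (<⇒≤ (low<b d)))
               (≤-trans (≤-reflexive (sym (square b₀))) b₀²≤b₀²+1))

      n≤b₀²+1 : x + y * b₀ ≤ b₀ ^ 2 + 1
      n≤b₀²+1 = ≤-trans (<⇒≤ (subst (_< b₀ ^ 2) (value d) (proj₁ (TwoDigits⇒propagating d))))
                        b₀²≤b₀²+1

      Y≡y+tn : Y ≡ y + t * (x + y * b₀)
      Y≡y+tn = rearrange b₀ t x y
        where
        rearrange : ∀ b₀ t x y → t * x + (1 + t * b₀) * y ≡ y + t * (x + y * b₀)
        rearrange = solve-∀

    lift : TwoDigits b (M * n)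
    lift = record
      { low    = X
      ; high   = Y
      ; low>0  = ≤-trans (low>0 d) (m≤m+n x (t * D))
      ; low<b  = +-mono-<-≤ (low<b d) (*-monoʳ-≤ t D≤b₀²+1)
      ; high<b = subst (_< b) (sym Y≡y+tn) (+-mono-<-≤ (high<b d) (*-monoʳ-≤ t n≤b₀²+1))
      ; value  = trans (cong (M *_) (value d)) (base-change x y X ax≡X+ty)
      }

    S-lift : S b (M * n) ≡ M * S b₀ n
    S-lift = begin
      S b (M * n)                  ≡⟨ S-TwoDigits lift ⟩
      X * X + Y * Y                ≡⟨ norm-multiplicative a t x y X ax≡X+ty ⟩
      M * (x * x + y * y)          ≡⟨ cong (M *_) (S-TwoDigits d) ⟨
      M * S b₀ n                   ∎
      where open ≡-Reasoning

  M*-injective : Injective _≡_ _≡_ (M *_)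
  M*-injective {m} {n} = *-cancelˡ-≡ m n M

  IsPropagatingCycle-lift : ∀ {xs} → IsPropagatingCycle b₀ xs → IsPropagatingCycle b (map (M *_) xs)
  IsPropagatingCycle-lift {xs} (cycle , propagating) =
    IsCycle-map M*-injective (λ {n} n>0 → ≤-trans n>0 (m≤n*m n M)) (All.map S-lift digits) cycle ,
    All.map⁺ (All.map (λ d → TwoDigits⇒propagating (lift d)) digits)
    where
    digits : All (TwoDigits b₀) xs
    digits = All.map (λ (n<b₀² , b₀∤n) → propagating⇒TwoDigits n<b₀² b₀∤n) propagating

theorem2p7 : (b₀ : ℕ) → 2 ≤ b₀ → (cs : List (List ℕ))
    → All (IsPropagatingCycle b₀) cs
    → AllPairs (λ x y → ¬ SameCycle x y) cs
    → (t : ℕ)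
    → ∃ λ (ds : List (List ℕ))
        → All (IsPropagatingCycle (b₀ + t * (b₀ ^ 2 + 1))) ds
        × AllPairs (λ x y → ¬ SameCycle x y) ds
        × map length ds ≡ map length cs
theorem2p7 b₀ 2≤b₀ cs cycles distinct t =
  map (map (M *_)) cs ,
  All.map⁺ (All.map IsPropagatingCycle-lift cycles) ,
  AllPairs.map⁺ (AllPairs.map (¬SameCycle-map M*-injective) distinct) ,
  trans (sym (map-∘ cs)) (map-cong (length-map (M *_)) cs)
  where open Lift b₀ t {{>-nonZero (≤-trans (s≤s z≤n) 2≤b₀)}}
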